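{- For any time warps $f,g$: (a) $\mathrm{last}(fg)=\omega$ if and only if ($\mathrm{last}(f)=\omega$ and $\mathrm{last}(g)=\omega$); (b) $\mathrm{last}(f)=\omega\iff\mathrm{last}(f^{r})=\omega\iff\mathrm{last}(f^{\ell})=\omega$.
   Context: Let $\overline{\omega}=\omega\cup\{\omega\}$ with its natural order. A time warp is a function $f:\overline{\omega}\to\overline{\omega}$ preserving all suprema; equivalently, a monotone function with $f(0)=0$ and $f(\omega)=\bigvee\{f(n)\mid n\in\omega\}$. The set of time warps is ordered pointwise; $fg:=f\circ g$; $\mathrm{id}$ is the identity; the residuals $\backslash,/$ satisfy $f\le h/g\iff fg\le h\iff g\le f\backslash h$. Define $f^{\ell}:=\mathrm{id}/f$, $f^{r}:=f\backslash\mathrm{id}$, and $\mathrm{last}(f):=\bigwedge\{p\in\overline{\omega}\mid f(p)=f(\omega)\}$. -}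

module Defs where

import Data.Nat

open import Data.Nat using (ℕ; zero) renaming (_≤_ to _≤ℕ_)
open import Relation.Binary.PropositionalEquality using (_≡_)
open import Function using (_∘_; id)
open import Function.Bundles using (_⇔_)
open import Data.Product using (_×_; _,_)
open import Data.Empty using (⊥-elim)
open import Data.Nat.Properties using (<-irrefl)
open import Relation.Binary.PropositionalEquality using (refl)

data ℕ∞ : Set where
  fin : ℕ → ℕ∞
  ω   : ℕ∞

data _≤∞_ : ℕ∞ → ℕ∞ → Set where
  fin≤fin : ∀ {m n} → m ≤ℕ n → fin m ≤∞ fin n
  _≤ω     : ∀ p → p ≤∞ ω

infix 4 _≤∞_

IsSup : (ℕ → ℕ∞) → ℕ∞ → Set
IsSup s p = (∀ n → s n ≤∞ p) × (∀ q → (∀ n → s n ≤∞ q) → p ≤∞ q)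

IsInf : (ℕ∞ → Set) → ℕ∞ → Set
IsInf S p = (∀ q → S q → p ≤∞ q) × (∀ r → (∀ q → S q → r ≤∞ q) → r ≤∞ p)

record TimeWarp : Set where
  field
    fun  : ℕ∞ → ℕ∞
    mono : ∀ {p q} → p ≤∞ q → fun p ≤∞ fun q
    zero-pres : fun (fin zero) ≡ fin zero
    sup-pres  : IsSup (λ n → fun (fin n)) (fun ω)
open TimeWarp public

_≤ᶠ_ : (ℕ∞ → ℕ∞) → (ℕ∞ → ℕ∞) → Set
f ≤ᶠ g = ∀ p → f p ≤∞ g p

infix 4 _≤ᶠ_

IsRightRes : TimeWarp → TimeWarp → TimeWarp → Set
IsRightRes h g r = ∀ (f : TimeWarp) → (fun f ≤ᶠ fun r) ⇔ (fun f ∘ fun g ≤ᶠ fun h)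

IsLeftRes : TimeWarp → TimeWarp → TimeWarp → Set
IsLeftRes f h r = ∀ (g : TimeWarp) → (fun g ≤ᶠ fun r) ⇔ (fun f ∘ fun g ≤ᶠ fun h)

idTW : TimeWarp
idTW = record
  { fun = id
  ; mono = id
  ; zero-pres = refl
  ; sup-pres = (λ n → fin n ≤ω) , (λ q h → lemma q h) }
  where
    lemma : ∀ q → (∀ n → fin n ≤∞ q) → ω ≤∞ q
    lemma (fin m) h with h (Data.Nat.suc m)
    ... | fin≤fin le = ⊥-elim (<-irrefl refl le)
    lemma ω h = ω ≤ω

IsLeftAdj : TimeWarp → TimeWarp → Set
IsLeftAdj f fℓ = IsRightRes idTW f fℓ

IsRightAdj : TimeWarp → TimeWarp → Set
IsRightAdj f fr = IsLeftRes f idTW fr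

LastIs : (ℕ∞ → ℕ∞) → ℕ∞ → Set
LastIs f p = IsInf (λ q → f q ≡ f ω) p

{-# OPTIONS --safe #-}
-- A function h : ω̄ → ω̄ has last(h) = ω exactly when h never attains h(ω) at a finite point.
-- For a time warp this means h(ω) = ω and h(n) < ω for all n ∈ ω, since a finite supremum
-- of a chain in ω̄ is attained.  This property is obviously closed under composition, and
-- conversely if f g has it then so does g, hence g is unbounded and f cannot become constant.
-- For (b), the counits f f^r ≤ id and f^ℓ f ≤ id transfer finiteness of values between f and
-- its adjoints, while the two-valued warps step a x (0 up to a, x beyond) satisfy
-- f ∘ step a x ≤ id and step a x ∘ f ≤ id whenever f(x) = a, so they lie below f^r and f^ℓ;
-- evaluating them shows that the adjoints send ω to ω.
module Submission where

open import Defs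
open import Data.Product using (_×_; _,_; proj₁; ∃)
open import Data.Product.Function.NonDependent.Propositional using (_×-⇔_)
open import Function using (_∘_; id)
open import Function.Bundles using (_⇔_; Equivalence; mk⇔)
open import Function.Properties.Equivalence using () renaming (sym to ⇔-sym; trans to ⇔-trans)
open import Data.Nat using (ℕ; zero; suc; z≤n; _≤?_)
import Data.Nat.Properties as ℕ
open import Data.Empty using (⊥-elim)
open import Relation.Nullary using (¬_; Dec; yes; no)
open import Relation.Binary.PropositionalEquality using (_≡_; _≢_; refl; sym; trans; subst; cong)

≤∞-refl : ∀ p → p ≤∞ p
≤∞-refl (fin n) = fin≤fin ℕ.≤-refl
≤∞-refl ω       = ω ≤ω

≤∞-trans : ∀ {p q r} → p ≤∞ q → q ≤∞ r → p ≤∞ r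
≤∞-trans (fin≤fin m≤n) (fin≤fin n≤k) = fin≤fin (ℕ.≤-trans m≤n n≤k)
≤∞-trans {p} _         (_ ≤ω)        = p ≤ω

≤∞-antisym : ∀ {p q} → p ≤∞ q → q ≤∞ p → p ≡ q
≤∞-antisym (fin≤fin m≤n) (fin≤fin n≤m) = cong fin (ℕ.≤-antisym m≤n n≤m)
≤∞-antisym (ω ≤ω)        (ω ≤ω)        = refl

≰∞⇒≥ : ∀ {p q} → ¬ p ≤∞ q → q ≤∞ p
≰∞⇒≥ {fin m} {fin n} p≰q = fin≤fin (ℕ.≰⇒≥ (p≰q ∘ fin≤fin))
≰∞⇒≥ {p}     {ω}     p≰q = ⊥-elim (p≰q (p ≤ω))
≰∞⇒≥ {ω}     {q}     _   = q ≤ω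

_≤∞?_ : ∀ p q → Dec (p ≤∞ q)
fin m ≤∞? fin n with m ≤? n
... | yes m≤n = yes (fin≤fin m≤n)
... | no  m≰n = no λ { (fin≤fin m≤n) → m≰n m≤n }
p     ≤∞? ω     = yes (p ≤ω)
ω     ≤∞? fin n = no λ ()

ω≰fin : ∀ {n} → ¬ ω ≤∞ fin n
ω≰fin ()

fin-suc≰fin : ∀ {n} → ¬ fin (suc n) ≤∞ fin n
fin-suc≰fin (fin≤fin 1+n≤n) = ℕ.<-irrefl refl 1+n≤n

ω≤⇒≡ω : ∀ {p} → ω ≤∞ p → p ≡ ω
ω≤⇒≡ω (ω ≤ω) = refl

0≤∞ : ∀ p → fin 0 ≤∞ p
0≤∞ (fin n) = fin≤fin z≤n
0≤∞ ω       = fin 0 ≤ω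

≤fin0⇒≡0 : ∀ {p} → p ≤∞ fin 0 → p ≡ fin 0
≤fin0⇒≡0 (fin≤fin z≤n) = refl

≤fin-suc∧≢⇒≤fin : ∀ {p k} → p ≤∞ fin (suc k) → p ≢ fin (suc k) → p ≤∞ fin k
≤fin-suc∧≢⇒≤fin (fin≤fin i≤1+k) i≢1+k =
  fin≤fin (ℕ.≤-pred (ℕ.≤∧≢⇒< i≤1+k (i≢1+k ∘ cong fin)))

≢ω⇒fin : ∀ {p} → p ≢ ω → ∃ λ n → p ≡ fin n
≢ω⇒fin {fin n} _   = n , refl
≢ω⇒fin {ω}     p≢ω = ⊥-elim (p≢ω refl)

≢fin⇒≡ω : ∀ {p} → (∀ n → p ≢ fin n) → p ≡ ω
≢fin⇒≡ω {fin n} p≢fin = ⊥-elim (p≢fin n refl)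
≢fin⇒≡ω {ω}     _     = refl

all-fin≤⇒≡ω : ∀ {p} → (∀ n → fin n ≤∞ p) → p ≡ ω
all-fin≤⇒≡ω {fin n} fin≤p = ⊥-elim (fin-suc≰fin (fin≤p (suc n)))
all-fin≤⇒≡ω {ω}     _     = refl

finite-sup-attained : ∀ {s m} → IsSup s (fin m) → ¬ (∀ n → s n ≢ fin m)
finite-sup-attained {m = zero}  (ub , _)   s≢0  = s≢0 0 (≤fin0⇒≡0 (ub 0))
finite-sup-attained {m = suc k} (ub , lub) s≢m  =
  fin-suc≰fin (lub (fin k) (λ n → ≤fin-suc∧≢⇒≤fin (ub n) (s≢m n)))

ω-sup-unbounded : ∀ {s} → IsSup s ω → ∀ m → ¬ (∀ n → ¬ fin m ≤∞ s n)
ω-sup-unbounded (_ , lub) m m≰s = ω≰fin (lub (fin m) (λ n → ≰∞⇒≥ (m≰s n)))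

≤ᶠ-refl : ∀ h → h ≤ᶠ h
≤ᶠ-refl h p = ≤∞-refl (h p)

sup-pres-ω : (h : TimeWarp) → fun h ω ≡ ω → IsSup (λ n → fun h (fin n)) ω
sup-pres-ω h hω = subst (IsSup _) hω (sup-pres h)

stable-above : (h : TimeWarp) → ∀ {k p} → fin k ≤∞ p →
               fun h (fin k) ≡ fun h ω → fun h p ≡ fun h ω
stable-above h {p = p} k≤p hk≡hω =
  ≤∞-antisym (mono h (p ≤ω)) (subst (_≤∞ fun h p) hk≡hω (mono h k≤p))

NeverStable : (ℕ∞ → ℕ∞) → Set
NeverStable h = ∀ n → h (fin n) ≢ h ω

MapsFinite : (ℕ∞ → ℕ∞) → Set
MapsFinite h = ∀ n → h (fin n) ≢ ω

Proper : (ℕ∞ → ℕ∞) → Set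
Proper h = (h ω ≡ ω) × MapsFinite h

last≡ω⇔neverStable : ∀ h → LastIs h ω ⇔ NeverStable h
last≡ω⇔neverStable h = mk⇔
  (λ (least , _) n hn≡hω → ω≰fin (least (fin n) hn≡hω))
  (λ never → (λ { (fin n) hn≡hω → ⊥-elim (never n hn≡hω) ; ω _ → ω ≤ω }) , (λ r _ → r ≤ω))

proper⇒neverStable : ∀ h → Proper h → NeverStable h
proper⇒neverStable h (hω , h-fin) n hn≡hω = h-fin n (trans hn≡hω hω)

neverStable⇒proper : (h : TimeWarp) → NeverStable (fun h) → Proper (fun h)
neverStable⇒proper h never = hω , λ n hn≡ω → never n (trans hn≡ω (sym hω))
  where
  hω : fun h ω ≡ ω
  hω = ≢fin⇒≡ω λ m hω≡m →
    finite-sup-attained (subst (IsSup _) hω≡m (sup-pres h))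
                        (λ n hn≡m → never n (trans hn≡m (sym hω≡m)))

last≡ω⇔proper : (h : TimeWarp) → LastIs (fun h) ω ⇔ Proper (fun h)
last≡ω⇔proper h = ⇔-trans (last≡ω⇔neverStable (fun h))
                          (mk⇔ (neverStable⇒proper h) (proper⇒neverStable (fun h)))

proper-∘ : ∀ f g → Proper f → Proper g → Proper (f ∘ g)
proper-∘ f g (fω , f-fin) (gω , g-fin) = trans (cong f gω) fω , fg-fin
  where
  fg-fin : MapsFinite (f ∘ g)
  fg-fin n with ≢ω⇒fin (g-fin n)
  ... | a , gn≡a = λ fgn≡ω → f-fin a (trans (cong f (sym gn≡a)) fgn≡ω)

neverStable-∘ʳ : ∀ f g → NeverStable (f ∘ g) → NeverStable g
neverStable-∘ʳ f g never n gn≡gω = never n (cong f gn≡gω)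

neverStable-∘ˡ : (f g : TimeWarp) → fun g ω ≡ ω →
                 NeverStable (fun f ∘ fun g) → NeverStable (fun f)
neverStable-∘ˡ f g gω never k fk≡fω =
  ω-sup-unbounded (sup-pres-ω g gω) k λ n k≤gn →
    never n (trans (stable-above f k≤gn fk≡fω) (cong (fun f) (sym gω)))

neverStable-∘ : (f g : TimeWarp) →
                NeverStable (fun f ∘ fun g) ⇔ (NeverStable (fun f) × NeverStable (fun g))
neverStable-∘ f g = mk⇔
  (λ never → let never-g = neverStable-∘ʳ (fun f) (fun g) never
             in neverStable-∘ˡ f g (proj₁ (neverStable⇒proper g never-g)) never , never-g)
  (λ (never-f , never-g) → proper⇒neverStable (fun f ∘ fun g)
     (proper-∘ (fun f) (fun g) (neverStable⇒proper f never-f) (neverStable⇒proper g never-g)))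

counit⇒mapsFiniteʳ : (L R : TimeWarp) → fun L ∘ fun R ≤ᶠ id →
                     fun L ω ≡ ω → MapsFinite (fun R)
counit⇒mapsFiniteʳ L R counit Lω n Rn≡ω =
  ω≰fin (subst (_≤∞ fin n) (trans (cong (fun L) Rn≡ω) Lω) (counit (fin n)))

counit⇒mapsFiniteˡ : (L R : TimeWarp) → fun L ∘ fun R ≤ᶠ id →
                     fun R ω ≡ ω → MapsFinite (fun L)
counit⇒mapsFiniteˡ L R counit Rω n Ln≡ω =
  ω-sup-unbounded (sup-pres-ω R Rω) n λ k n≤Rk →
    ω≰fin (subst (_≤∞ fin k) Ln≡ω (≤∞-trans (mono L n≤Rk) (counit (fin k))))

stepf : ℕ → ℕ∞ → ℕ∞ → ℕ∞
stepf a x p with p ≤∞? fin a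
... | yes _ = fin 0
... | no  _ = x

step-below : ∀ a x {p} → p ≤∞ fin a → stepf a x p ≡ fin 0
step-below a x {p} p≤a with p ≤∞? fin a
... | yes _   = refl
... | no  p≰a = ⊥-elim (p≰a p≤a)

step-above : ∀ a x {p} → ¬ p ≤∞ fin a → stepf a x p ≡ x
step-above a x {p} p≰a with p ≤∞? fin a
... | yes p≤a = ⊥-elim (p≰a p≤a)
... | no  _   = refl

step-mono : ∀ a x {p q} → p ≤∞ q → stepf a x p ≤∞ stepf a x q
step-mono a x {p} {q} p≤q with p ≤∞? fin a | q ≤∞? fin a
... | yes _   | yes _   = ≤∞-refl (fin 0)
... | yes _   | no  _   = 0≤∞ x
... | no  p≰a | yes q≤a = ⊥-elim (p≰a (≤∞-trans p≤q q≤a))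
... | no  _   | no  _   = ≤∞-refl x

step : ℕ → ℕ∞ → TimeWarp
step a x = record
  { fun       = stepf a x
  ; mono      = step-mono a x
  ; zero-pres = step-below a x (0≤∞ (fin a))
  ; sup-pres  = (λ n → step-mono a x (fin n ≤ω))
              , (λ q bounded → subst (_≤∞ q) (step-above a x fin-suc≰fin) (bounded (suc a)))
  }

f∘step≤id : (f : TimeWarp) → ∀ {a x} → fun f x ≡ fin a → fun f ∘ stepf a x ≤ᶠ id
f∘step≤id f {a} {x} fx≡a p with p ≤∞? fin a
... | yes _   = subst (_≤∞ p) (sym (zero-pres f)) (0≤∞ p)
... | no  p≰a = subst (_≤∞ p) (sym fx≡a) (≰∞⇒≥ p≰a)

step∘f≤id : (f : TimeWarp) → ∀ {a x} → fun f x ≡ fin a → stepf a x ∘ fun f ≤ᶠ id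
step∘f≤id f {a} {x} fx≡a p with fun f p ≤∞? fin a
... | yes _    = 0≤∞ p
... | no  fp≰a = ≰∞⇒≥ λ p≤x → fp≰a (subst (fun f p ≤∞_) fx≡a (mono f p≤x))

DominatesSteps : TimeWarp → TimeWarp → Set
DominatesSteps f g = ∀ a x → fun f x ≡ fin a → stepf a x ≤ᶠ fun g

rightAdj-dominatesSteps : ∀ f fr → IsRightAdj f fr → DominatesSteps f fr
rightAdj-dominatesSteps f fr adj a x fx≡a =
  Equivalence.from (adj (step a x)) (f∘step≤id f fx≡a)

leftAdj-dominatesSteps : ∀ f fℓ → IsLeftAdj f fℓ → DominatesSteps f fℓ
leftAdj-dominatesSteps f fℓ adj a x fx≡a =
  Equivalence.from (adj (step a x)) (step∘f≤id f fx≡a)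

dominatesSteps⇒ω↦ωʳ : ∀ f g → DominatesSteps f g → MapsFinite (fun f) → fun g ω ≡ ω
dominatesSteps⇒ω↦ωʳ f g dominates f-fin = all-fin≤⇒≡ω λ n →
  let a , fn≡a = ≢ω⇒fin (f-fin n) in dominates a (fin n) fn≡a ω

dominatesSteps⇒ω↦ωˡ : ∀ f g → DominatesSteps f g → MapsFinite (fun g) → fun f ω ≡ ω
dominatesSteps⇒ω↦ωˡ f g dominates g-fin = ≢fin⇒≡ω λ m fω≡m →
  g-fin (suc m) (ω≤⇒≡ω (subst (_≤∞ fun g (fin (suc m)))
                              (step-above m ω fin-suc≰fin)
                              (dominates m ω fω≡m (fin (suc m)))))

proper⇔proper-rightAdj : ∀ f fr → IsRightAdj f fr → Proper (fun f) ⇔ Proper (fun fr)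
proper⇔proper-rightAdj f fr adj = mk⇔
  (λ (fω , f-fin) → dominatesSteps⇒ω↦ωʳ f fr dominates f-fin
                  , counit⇒mapsFiniteʳ f fr counit fω)
  (λ (frω , fr-fin) → dominatesSteps⇒ω↦ωˡ f fr dominates fr-fin
                    , counit⇒mapsFiniteˡ f fr counit frω)
  where
  counit : fun f ∘ fun fr ≤ᶠ id
  counit = Equivalence.to (adj fr) (≤ᶠ-refl (fun fr))
  dominates : DominatesSteps f fr
  dominates = rightAdj-dominatesSteps f fr adj

proper⇔proper-leftAdj : ∀ f fℓ → IsLeftAdj f fℓ → Proper (fun f) ⇔ Proper (fun fℓ)
proper⇔proper-leftAdj f fℓ adj = mk⇔
  (λ (fω , f-fin) → dominatesSteps⇒ω↦ωʳ f fℓ dominates f-fin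
                  , counit⇒mapsFiniteˡ fℓ f counit fω)
  (λ (fℓω , fℓ-fin) → dominatesSteps⇒ω↦ωˡ f fℓ dominates fℓ-fin
                    , counit⇒mapsFiniteʳ fℓ f counit fℓω)
  where
  counit : fun fℓ ∘ fun f ≤ᶠ id
  counit = Equivalence.to (adj fℓ) (≤ᶠ-refl (fun fℓ))
  dominates : DominatesSteps f fℓ
  dominates = leftAdj-dominatesSteps f fℓ adj

lemma2p11 : (∀ (f g : TimeWarp) →
                LastIs (fun f ∘ fun g) ω ⇔ (LastIs (fun f) ω × LastIs (fun g) ω))
            × (∀ (f fr fℓ : TimeWarp) → IsRightAdj f fr → IsLeftAdj f fℓ →
                (LastIs (fun f) ω ⇔ LastIs (fun fr) ω) × (LastIs (fun fr) ω ⇔ LastIs (fun fℓ) ω))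
lemma2p11 = last≡ω-∘ , last≡ω-adjoints
  where
  last≡ω-∘ : ∀ f g → LastIs (fun f ∘ fun g) ω ⇔ (LastIs (fun f) ω × LastIs (fun g) ω)
  last≡ω-∘ f g = ⇔-trans (last≡ω⇔neverStable (fun f ∘ fun g))
    (⇔-trans (neverStable-∘ f g)
             (⇔-sym (last≡ω⇔neverStable (fun f) ×-⇔ last≡ω⇔neverStable (fun g))))

  last≡ω-adjoints : ∀ f fr fℓ → IsRightAdj f fr → IsLeftAdj f fℓ →
    (LastIs (fun f) ω ⇔ LastIs (fun fr) ω) × (LastIs (fun fr) ω ⇔ LastIs (fun fℓ) ω)
  last≡ω-adjoints f fr fℓ adjR adjL = f⇔fr , ⇔-trans (⇔-sym f⇔fr) f⇔fℓ
    where
    via-proper : ∀ g → Proper (fun f) ⇔ Proper (fun g) → LastIs (fun f) ω ⇔ LastIs (fun g) ω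
    via-proper g f⇔g = ⇔-trans (last≡ω⇔proper f) (⇔-trans f⇔g (⇔-sym (last≡ω⇔proper g)))
    f⇔fr : LastIs (fun f) ω ⇔ LastIs (fun fr) ω
    f⇔fr = via-proper fr (proper⇔proper-rightAdj f fr adjR)
    f⇔fℓ : LastIs (fun f) ω ⇔ LastIs (fun fℓ) ω
    f⇔fℓ = via-proper fℓ (proper⇔proper-leftAdj f fℓ adjL)
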